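{- Let $A$ be a 2-line array and write $f(A)=(B,p,q)$. Let $\alpha$ and $\beta$ be the words formed by the values of $A$ and of $B$, respectively. Then $$\alpha\equiv_i\beta\cdot p\qquad\text{and}\qquad f(A^{\star})=(B^{\star},q,p),$$ where $\beta\cdot p$ is the concatenation of $\beta$ with the word $p$ (read left to right).
   Context: A 2-line array is a two-row array of positive integers of equal length whose columns are in lexicographic order from left to right (top entries taking precedence); top entries are indices, bottom entries are values. $A^{\star}$ is obtained by swapping the rows of $A$ and reordering columns lexicographically. $\mathrm{RSK}$ is the classical Robinson–Schensted–Knuth bijection from 2-line arrays of length $n$ to pairs $(P(A),Q(A))$ of semistandard Young tableaux of the same shape with $n$ boxes (insertion and recording tableaux). For a tableau $T$, $\widehat T$ is obtained by deleting its top row. Define $f(A)=(B,p,q)$ where $p$ and $q$ are the top rows of $P(A)$ and $Q(A)$ and $B=\mathrm{RSK}^{ -1}(\widehat{P(A)},\widehat{Q(A)})$. i-Knuth equivalence $\equiv_i$ on words is generated by the moves $\cdots a\cdots\leftrightarrow\cdots aa\cdots$, $\cdots bca\cdots\leftrightarrow\cdots bac\cdots$ ($a<b\le c$), and $\cdots acb\cdots\leftrightarrow\cdots cab\cdots$ ($a\le b<c$). -}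

module Defs where

open import Data.Bool using (Bool; true; false; if_then_else_)
open import Data.Nat using (ℕ; zero; suc; _≤_; _<_; _≤ᵇ_; _<ᵇ_; _≡ᵇ_)
open import Data.Product using (_×_; _,_; proj₁; proj₂; swap)
open import Data.Sum using (_⊎_)
open import Data.List using (List; []; _∷_; _++_; map; [_]; tail)
open import Data.Maybe using (Maybe; just; nothing; fromMaybe)
open import Data.List.Relation.Unary.All using (All)
open import Data.List.Relation.Unary.Linked using (Linked)
open import Relation.Binary.PropositionalEquality using (_≡_)
open import Relation.Binary.Construct.Closure.Equivalence using (EqClosure)

Word : Set
Word = List ℕ

-- A column: (top entry = index , bottom entry = value).
Column : Set
Column = ℕ × ℕ

Array : Set
Array = List Column

_≤lex_ : Column → Column → Set
(i , v) ≤lex (j , w) = i < j ⊎ (i ≡ j × v ≤ w)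

_≤lexᵇ_ : Column → Column → Bool
(i , v) ≤lexᵇ (j , w) = if i <ᵇ j then true else (if i ≡ᵇ j then v ≤ᵇ w else false)

Positive : Column → Set
Positive (i , v) = 1 ≤ i × 1 ≤ v

IsTwoLineArray : Array → Set
IsTwoLineArray A = All Positive A × Linked _≤lex_ A

insertLex : Column → Array → Array
insertLex c [] = c ∷ []
insertLex c (d ∷ ds) = if c ≤lexᵇ d then c ∷ d ∷ ds else d ∷ insertLex c ds

sortLex : Array → Array
sortLex [] = []
sortLex (c ∷ cs) = insertLex c (sortLex cs)

_⋆ : Array → Array
A ⋆ = sortLex (map swap A)

values : Array → Word
values A = map proj₂ A

-- A tableau is a list of rows, top row first.
Tableau : Set
Tableau = List Word

rowInsert : ℕ → Word → Word × Maybe ℕ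
rowInsert x [] = x ∷ [] , nothing
rowInsert x (y ∷ ys) with x <ᵇ y
... | true  = x ∷ ys , just y
... | false with rowInsert x ys
...   | (ys' , b) = y ∷ ys' , b

-- Schensted insertion of x into P; returns the new tableau and the index
-- (0 = top) of the row in which the new box was created.
insertT : ℕ → Tableau → Tableau × ℕ
insertT x [] = (x ∷ []) ∷ [] , 0
insertT x (r ∷ rs) with rowInsert x r
... | (r' , nothing) = r' ∷ rs , 0
... | (r' , just y) with insertT y rs
...   | (rs' , k) = r' ∷ rs' , suc k

addAt : ℕ → ℕ → Tableau → Tableau
addAt zero    i []       = (i ∷ []) ∷ []
addAt zero    i (r ∷ rs) = (r ++ (i ∷ [])) ∷ rs
addAt (suc k) i []       = (i ∷ []) ∷ []
addAt (suc k) i (r ∷ rs) = r ∷ addAt k i rs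

rskFrom : Tableau × Tableau → Array → Tableau × Tableau
rskFrom PQ [] = PQ
rskFrom (P , Q) ((i , v) ∷ A) with insertT v P
... | (P' , k) = rskFrom (P' , addAt k i Q) A

RSK : Array → Tableau × Tableau
RSK A = rskFrom ([] , []) A

P : Array → Tableau
P A = proj₁ (RSK A)

Q : Array → Tableau
Q A = proj₂ (RSK A)

topRow : Tableau → Word
topRow [] = []
topRow (r ∷ _) = r

hat : Tableau → Tableau
hat [] = []
hat (_ ∷ rs) = rs

-- f(A) = (B , p , q):  p = top row of P(A), q = top row of Q(A),
-- B = RSK⁻¹(P̂(A) , Q̂(A)), i.e. B is the (unique, RSK being injective)
-- 2-line array with RSK(B) = (P̂(A) , Q̂(A)).

IsF : Array → Array → Word → Word → Set
IsF A B p q =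
  IsTwoLineArray B × RSK B ≡ (hat (P A) , hat (Q A)) ×
  p ≡ topRow (P A) × q ≡ topRow (Q A)

data IKnuthStep : Word → Word → Set where
  dup  : ∀ u v a → IKnuthStep (u ++ a ∷ v) (u ++ a ∷ a ∷ v)
  knA  : ∀ u v a b c → a < b → b ≤ c →
         IKnuthStep (u ++ b ∷ c ∷ a ∷ v) (u ++ b ∷ a ∷ c ∷ v)
  knB  : ∀ u v a b c → a ≤ b → b < c →
         IKnuthStep (u ++ a ∷ c ∷ b ∷ v) (u ++ c ∷ a ∷ b ∷ v)

_≡ᵢ_ : Word → Word → Set
_≡ᵢ_ = EqClosure IKnuthStep

-- Each row insertion rewrites the row reading word by Knuth moves, so the
-- values of A are i-Knuth equivalent to the reading word of P(A), which is
-- the reading word of P̂(A) = P(B) followed by the top row p.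
--
-- Running the columns of A through the top row alone yields the top rows of
-- P(A) and Q(A) and the array B of the columns (index , bumped entry); the
-- remaining rows are RSK(B).  The second claim is thus the symmetry
-- RSK(A⋆) = swap RSK(A), by induction on the length of A.  Inserting into a
-- row with first entry x, the first entry is replaced exactly at the strict
-- running minima ("records") of the values.  The records of the values of A,
-- scanned in index order, are the records of the indices of A⋆, scanned in
-- value order, and the entries they bump correspond as well; removing them
-- and inducting shows that the top rows of P and Q are exchanged and that
-- the bumped arrays of A and A⋆ are swapped copies of each other.
module Submission where

open import Defs
open import Data.Bool using (true; false; if_then_else_)
open import Data.Empty using (⊥-elim)
open import Data.Maybe using (Maybe; just; nothing)
open import Data.Maybe.Relation.Unary.All as MaybeAll using (just; nothing)
open import Data.Nat using (ℕ; zero; suc; _≤_; _<_; _<ᵇ_; _≡ᵇ_; _≤ᵇ_; _<?_; z≤n; s≤s; z<s)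
open import Data.Nat.Properties
open import Data.Product using (Σ; _×_; _,_; proj₁; proj₂; swap)
import Data.Product as Prod
open import Data.Product.Relation.Binary.Lex.Strict using (×-transitive)
open import Data.Sum using (inj₁; inj₂)
open import Data.List using ([]; _∷_; _++_; _∷ʳ_; map; [_]; length; fromMaybe)
open import Data.List.Properties using (++-assoc; ++-identityʳ; map-++)
open import Data.List.Reverse using (Reverse; []; _∶_∶ʳ_; reverseView)
open import Data.List.Membership.Propositional using (_∈_)
open import Data.List.Membership.Propositional.Properties using (∈-∃++; ∈-map⁺; ∈-++⁺ʳ)
open import Data.List.Relation.Unary.Any using (here; there)
open import Data.List.Relation.Unary.All as All using (All; []; _∷_)
open import Data.List.Relation.Unary.All.Properties using ()
  renaming (map⁺ to All-map⁺; ++⁺ to All-++⁺; ++⁻ to All-++⁻)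
open import Data.List.Relation.Unary.AllPairs as AllPairs using (AllPairs; []; _∷_)
open import Data.List.Relation.Unary.Linked as Linked using (Linked; []; [-]; _∷_)
open import Data.List.Relation.Unary.Linked.Properties using (Linked⇒All; AllPairs⇒Linked; Linked⇒AllPairs)
open import Data.List.Relation.Binary.Permutation.Propositional
  using (_↭_; ↭-refl; ↭-sym; ↭-trans; ↭-prep; ↭-swap; ↭-reflexive; module PermutationReasoning)
open import Data.List.Relation.Binary.Permutation.Propositional.Properties
  using (All-resp-↭; ∈-resp-↭; shift; ∷↭∷ʳ; drop-mid; ↭-empty-inv; ↭-singleton-inv)
  renaming (map⁺ to ↭-map⁺; ++⁺ to ↭-++⁺)
open import Function using (_∘_)
open import Relation.Nullary using (¬_; yes; no)
open import Relation.Nullary.Reflects using (ofʸ; ofⁿ; fromEquivalence)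
open import Relation.Binary.Bundles using (Setoid)
open import Relation.Binary.PropositionalEquality
  using (_≡_; refl; sym; trans; cong; cong₂; subst; isEquivalence; resp₂; module ≡-Reasoning)
open import Relation.Binary.Construct.Closure.Equivalence using (gmap; return; setoid)
open import Relation.Binary.Construct.Closure.ReflexiveTransitive using (ε)
import Relation.Binary.Reasoning.Setoid

Sorted : Word → Set
Sorted = Linked _≤_

Sorted-head : ∀ {y ys} → Sorted (y ∷ ys) → All (y ≤_) ys
Sorted-head s = All.tail (Linked⇒All ≤-trans ≤-refl s)

Sorted-∷ : ∀ {y ys} → All (y ≤_) ys → Sorted ys → Sorted (y ∷ ys)
Sorted-∷ [] _ = [-]
Sorted-∷ (y≤z ∷ _) s = y≤z ∷ s

data RowInsert (v : ℕ) : Word → Word → Maybe ℕ → Set where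
  append : RowInsert v [] (v ∷ []) nothing
  bump   : ∀ {y ys} → v < y → RowInsert v (y ∷ ys) (v ∷ ys) (just y)
  skip   : ∀ {y ys ys′ b} → y ≤ v → RowInsert v ys ys′ b → RowInsert v (y ∷ ys) (y ∷ ys′) b

rowInsert-view : ∀ v r → RowInsert v r (proj₁ (rowInsert v r)) (proj₂ (rowInsert v r))
rowInsert-view v [] = append
rowInsert-view v (y ∷ ys) with v <ᵇ y | <ᵇ-reflects-< v y
... | true  | ofʸ v<y = bump v<y
... | false | ofⁿ v≮y = skip (≮⇒≥ v≮y) (rowInsert-view v ys)

RowInsert-append : ∀ {v r r′} → RowInsert v r r′ nothing → r′ ≡ r ++ [ v ]
RowInsert-append append = refl
RowInsert-append (skip _ p) = cong (_ ∷_) (RowInsert-append p)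

RowInsert-append-≤ : ∀ {v r r′} → RowInsert v r r′ nothing → All (_≤ v) r′
RowInsert-append-≤ append = ≤-refl ∷ []
RowInsert-append-≤ (skip y≤v p) = y≤v ∷ RowInsert-append-≤ p

RowInsert-just : ∀ {v r r′ y} → RowInsert v r r′ (just y) → y ∈ r × v < y
RowInsert-just (bump v<y) = here refl , v<y
RowInsert-just (skip _ p) = Prod.map₁ there (RowInsert-just p)

RowInsert-All : ∀ {P : ℕ → Set} {v r r′ b} → All P r → P v → RowInsert v r r′ b → All P r′
RowInsert-All [] pv append = pv ∷ []
RowInsert-All (_ ∷ ps) pv (bump _) = pv ∷ ps
RowInsert-All (py ∷ ps) pv (skip _ p) = py ∷ RowInsert-All ps pv p

RowInsert-sorted : ∀ {v r r′ b} → Sorted r → RowInsert v r r′ b → Sorted r′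
RowInsert-sorted _ append = [-]
RowInsert-sorted s (bump v<y) =
  Sorted-∷ (All.map (≤-trans (<⇒≤ v<y)) (Sorted-head s)) (Linked.tail s)
RowInsert-sorted s (skip y≤v p) =
  Sorted-∷ (RowInsert-All (Sorted-head s) y≤v p) (RowInsert-sorted (Linked.tail s) p)

RowInsert-bumped-≤ : ∀ {v r r′ y x} → Sorted r → RowInsert v r r′ (just y) →
  x ∈ r′ → v < x → y ≤ x
RowInsert-bumped-≤ s (bump _) (here refl) v<v = ⊥-elim (<-irrefl refl v<v)
RowInsert-bumped-≤ s (bump _) (there x∈ys) _ = All.lookup (Sorted-head s) x∈ys
RowInsert-bumped-≤ s (skip y≤v _) (here refl) v<y = ⊥-elim (<⇒≱ v<y y≤v)
RowInsert-bumped-≤ s (skip _ p) (there x∈ys′) v<x = RowInsert-bumped-≤ (Linked.tail s) p x∈ys′ v<x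

-- Knuth moves and the reading word

IKnuthStep-++ˡ : ∀ u {x y} → IKnuthStep x y → IKnuthStep (u ++ x) (u ++ y)
IKnuthStep-++ˡ u (dup w v a)
  rewrite sym (++-assoc u w (a ∷ v)) | sym (++-assoc u w (a ∷ a ∷ v)) = dup (u ++ w) v a
IKnuthStep-++ˡ u (knA w v a b c a<b b≤c)
  rewrite sym (++-assoc u w (b ∷ c ∷ a ∷ v)) | sym (++-assoc u w (b ∷ a ∷ c ∷ v)) =
  knA (u ++ w) v a b c a<b b≤c
IKnuthStep-++ˡ u (knB w v a b c a≤b b<c)
  rewrite sym (++-assoc u w (a ∷ c ∷ b ∷ v)) | sym (++-assoc u w (c ∷ a ∷ b ∷ v)) =
  knB (u ++ w) v a b c a≤b b<c

IKnuthStep-++ʳ : ∀ p {x y} → IKnuthStep x y → IKnuthStep (x ++ p) (y ++ p)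
IKnuthStep-++ʳ p (dup w v a)
  rewrite ++-assoc w (a ∷ v) p | ++-assoc w (a ∷ a ∷ v) p = dup w (v ++ p) a
IKnuthStep-++ʳ p (knA w v a b c a<b b≤c)
  rewrite ++-assoc w (b ∷ c ∷ a ∷ v) p | ++-assoc w (b ∷ a ∷ c ∷ v) p = knA w (v ++ p) a b c a<b b≤c
IKnuthStep-++ʳ p (knB w v a b c a≤b b<c)
  rewrite ++-assoc w (a ∷ c ∷ b ∷ v) p | ++-assoc w (c ∷ a ∷ b ∷ v) p = knB w (v ++ p) a b c a≤b b<c

≡ᵢ-++ˡ : ∀ u {x y} → x ≡ᵢ y → (u ++ x) ≡ᵢ (u ++ y)
≡ᵢ-++ˡ u = gmap (u ++_) (IKnuthStep-++ˡ u)

≡ᵢ-++ʳ : ∀ p {x y} → x ≡ᵢ y → (x ++ p) ≡ᵢ (y ++ p)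
≡ᵢ-++ʳ p = gmap (_++ p) (IKnuthStep-++ʳ p)

open Setoid (setoid IKnuthStep) using () renaming (reflexive to ≡⇒≡ᵢ)
module ≡ᵢ-Reasoning = Relation.Binary.Reasoning.Setoid (setoid IKnuthStep)

-- v travels leftwards through the row by moves  b c a → b a c  (a < b ≤ c).
≡ᵢ-insertBelow : ∀ {z zs v} → Sorted (z ∷ zs) → v < z → (z ∷ zs ++ [ v ]) ≡ᵢ (z ∷ v ∷ zs)
≡ᵢ-insertBelow {zs = []} _ _ = ε
≡ᵢ-insertBelow {z} {z′ ∷ zs} {v} (z≤z′ ∷ s) v<z = begin
  z ∷ z′ ∷ zs ++ [ v ]  ≈⟨ ≡ᵢ-++ˡ [ z ] (≡ᵢ-insertBelow s (<-≤-trans v<z z≤z′)) ⟩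
  z ∷ z′ ∷ v ∷ zs       ≈⟨ return (knA [] zs v z z′ v<z z≤z′) ⟩
  z ∷ v ∷ z′ ∷ zs       ∎
  where open ≡ᵢ-Reasoning

-- The bumped entry y travels leftwards by moves  a c b → c a b  (a ≤ b < c).
≡ᵢ-rowInsert-bump : ∀ {v r r′ y} → Sorted r → RowInsert v r r′ (just y) → (r ++ [ v ]) ≡ᵢ (y ∷ r′)
≡ᵢ-rowInsert-bump s (bump v<y) = ≡ᵢ-insertBelow s v<y
≡ᵢ-rowInsert-bump {v} {z ∷ zs} {z ∷ zs′} {y} s (skip z≤v p) = begin
  z ∷ zs ++ [ v ]  ≈⟨ ≡ᵢ-++ˡ [ z ] (≡ᵢ-rowInsert-bump (Linked.tail s) p) ⟩
  z ∷ y ∷ zs′      ≈⟨ return (passBumped p s) ⟩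
  y ∷ z ∷ zs′      ∎
  where
  open ≡ᵢ-Reasoning
  passBumped : ∀ {zs zs′} → RowInsert v zs zs′ (just y) → Sorted (z ∷ zs) →
    IKnuthStep (z ∷ y ∷ zs′) (y ∷ z ∷ zs′)
  passBumped {zs′ = _ ∷ ys} (bump v<y) _ = knB [] ys z v y z≤v v<y
  passBumped {zs′ = z′ ∷ ys} (skip z′≤v q) (z≤z′ ∷ _) =
    knB [] ys z z′ y z≤z′ (≤-<-trans z′≤v (proj₂ (RowInsert-just q)))

reading : Tableau → Word
reading [] = []
reading (r ∷ rs) = reading rs ++ r

reading-hat : ∀ T → reading T ≡ reading (hat T) ++ topRow T
reading-hat [] = refl
reading-hat (r ∷ rs) = refl

RowsSorted : Tableau → Set
RowsSorted = All Sorted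

insertT-rowsSorted : ∀ v T → RowsSorted T → RowsSorted (proj₁ (insertT v T))
insertT-rowsSorted v [] _ = [-] ∷ []
insertT-rowsSorted v (r ∷ rs) (sr ∷ srs) with rowInsert v r | rowInsert-view v r
... | (r′ , nothing) | p = RowInsert-sorted sr p ∷ srs
... | (r′ , just y) | p with insertT y rs | insertT-rowsSorted y rs srs
...   | (rs′ , _) | srs′ = RowInsert-sorted sr p ∷ srs′

≡ᵢ-insertT : ∀ v T → RowsSorted T → (reading T ++ [ v ]) ≡ᵢ reading (proj₁ (insertT v T))
≡ᵢ-insertT v [] _ = ε
≡ᵢ-insertT v (r ∷ rs) (sr ∷ srs) with rowInsert v r | rowInsert-view v r
... | (r′ , nothing) | p = ≡⇒≡ᵢ (begin
  (reading rs ++ r) ++ [ v ]  ≡⟨ ++-assoc (reading rs) r [ v ] ⟩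
  reading rs ++ r ++ [ v ]    ≡⟨ cong (reading rs ++_) (RowInsert-append p) ⟨
  reading rs ++ r′            ∎)
  where open ≡-Reasoning
... | (r′ , just y) | p with insertT y rs | ≡ᵢ-insertT y rs srs
...   | (rs′ , _) | ih = begin
  (reading rs ++ r) ++ [ v ]  ≡⟨ ++-assoc (reading rs) r [ v ] ⟩
  reading rs ++ r ++ [ v ]    ≈⟨ ≡ᵢ-++ˡ (reading rs) (≡ᵢ-rowInsert-bump sr p) ⟩
  reading rs ++ y ∷ r′        ≡⟨ ++-assoc (reading rs) [ y ] r′ ⟨
  (reading rs ++ [ y ]) ++ r′  ≈⟨ ≡ᵢ-++ʳ r′ ih ⟩
  reading rs′ ++ r′           ∎
  where open ≡ᵢ-Reasoning

≡ᵢ-rskFrom : ∀ T U A → RowsSorted T → (reading T ++ values A) ≡ᵢ reading (proj₁ (rskFrom (T , U) A))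
≡ᵢ-rskFrom T U [] _ = ≡⇒≡ᵢ (++-identityʳ (reading T))
≡ᵢ-rskFrom T U ((i , v) ∷ A) sT
  with insertT v T | ≡ᵢ-insertT v T sT | insertT-rowsSorted v T sT
... | (T′ , k) | ins | sT′ = begin
  reading T ++ v ∷ values A       ≡⟨ ++-assoc (reading T) [ v ] (values A) ⟨
  (reading T ++ [ v ]) ++ values A ≈⟨ ≡ᵢ-++ʳ (values A) ins ⟩
  reading T′ ++ values A          ≈⟨ ≡ᵢ-rskFrom T′ (addAt k i U) A sT′ ⟩
  reading (proj₁ (rskFrom (T′ , addAt k i U) A)) ∎
  where open ≡ᵢ-Reasoning

≡ᵢ-reading-P : ∀ A → values A ≡ᵢ reading (P A)
≡ᵢ-reading-P A = ≡ᵢ-rskFrom [] [] A []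

≤lex-trans : ∀ {a b c} → a ≤lex b → b ≤lex c → a ≤lex c
≤lex-trans = ×-transitive {_≈₁_ = _≡_} {_<₁_ = _<_} {_<₂_ = _≤_} isEquivalence (resp₂ _<_) <-trans ≤-trans

≤lex⇒≤ : ∀ {i v j w} → (i , v) ≤lex (j , w) → i ≤ j
≤lex⇒≤ (inj₁ i<j) = <⇒≤ i<j
≤lex⇒≤ (inj₂ (refl , _)) = ≤-refl

zero-≤lex : ∀ c → (0 , 0) ≤lex c
zero-≤lex (zero , v) = inj₂ (refl , z≤n)
zero-≤lex (suc i , v) = inj₁ z<s

≤lex-index-< : ∀ {i v j w} → (i , v) ≤lex (j , w) → w < v → i < j
≤lex-index-< (inj₁ i<j) _ = i<j
≤lex-index-< (inj₂ (_ , v≤w)) w<v = ⊥-elim (<⇒≱ w<v v≤w)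

≤lex-swap-antisym : ∀ {a b c d} → (a , b) ≤lex (c , d) → (d , c) ≤lex (b , a) → c ≤ a → (a , b) ≡ (c , d)
≤lex-swap-antisym (inj₁ a<c) _ c≤a = ⊥-elim (<⇒≱ a<c c≤a)
≤lex-swap-antisym (inj₂ (refl , b≤d)) (inj₁ d<b) _ = ⊥-elim (<⇒≱ d<b b≤d)
≤lex-swap-antisym (inj₂ (refl , _)) (inj₂ (refl , _)) _ = refl

SortedArray : Array → Set
SortedArray = AllPairs _≤lex_

≤lexᵇ-sound : ∀ c d → if c ≤lexᵇ d then c ≤lex d else d ≤lex c
≤lexᵇ-sound (i , v) (j , w) with i <ᵇ j | <ᵇ-reflects-< i j
... | true  | ofʸ i<j = inj₁ i<j
... | false | ofⁿ i≮j with i ≡ᵇ j | fromEquivalence (≡ᵇ⇒≡ i j) (≡⇒≡ᵇ i j)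
...   | false | ofⁿ i≢j = inj₁ (≤∧≢⇒< (≮⇒≥ i≮j) (i≢j ∘ sym))
...   | true  | ofʸ refl with v ≤ᵇ w | ≤ᵇ-reflects-≤ v w
...     | true  | ofʸ v≤w = inj₂ (refl , v≤w)
...     | false | ofⁿ v≰w = inj₂ (refl , <⇒≤ (≰⇒> v≰w))

insertLex-↭ : ∀ c L → insertLex c L ↭ c ∷ L
insertLex-↭ c [] = ↭-refl
insertLex-↭ c (d ∷ ds) with c ≤lexᵇ d
... | true  = ↭-refl
... | false = ↭-trans (↭-prep d (insertLex-↭ c ds)) (↭-swap d c ↭-refl)

insertLex-sorted : ∀ c L → SortedArray L → SortedArray (insertLex c L)
insertLex-sorted c [] [] = [] ∷ []
insertLex-sorted c (d ∷ ds) (d≤ds ∷ sds) with c ≤lexᵇ d | ≤lexᵇ-sound c d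
... | true  | c≤d = (c≤d ∷ All.map (≤lex-trans c≤d) d≤ds) ∷ d≤ds ∷ sds
... | false | d≤c = All-resp-↭ (↭-sym (insertLex-↭ c ds)) (d≤c ∷ d≤ds) ∷ insertLex-sorted c ds sds

sortLex-↭ : ∀ L → sortLex L ↭ L
sortLex-↭ [] = ↭-refl
sortLex-↭ (c ∷ L) = ↭-trans (insertLex-↭ c (sortLex L)) (↭-prep c (sortLex-↭ L))

sortLex-sorted : ∀ L → SortedArray (sortLex L)
sortLex-sorted [] = []
sortLex-sorted (c ∷ L) = insertLex-sorted c (sortLex L) (sortLex-sorted L)

⋆-↭ : ∀ A → (A ⋆) ↭ map swap A
⋆-↭ A = sortLex-↭ (map swap A)

⋆-sorted : ∀ A → SortedArray (A ⋆)
⋆-sorted A = sortLex-sorted (map swap A)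

⋆-isTwoLineArray : ∀ {A} → IsTwoLineArray A → IsTwoLineArray (A ⋆)
⋆-isTwoLineArray {A} (positive , _) =
  All-resp-↭ (↭-sym (⋆-↭ A)) (All-map⁺ (All.map Prod.swap positive)) , AllPairs⇒Linked (⋆-sorted A)

-- RSK through the top row

-- The B of the theorem is bumped [] A.
insertAll : Word → Array → Word
insertAll r [] = r
insertAll r ((i , v) ∷ A) = insertAll (proj₁ (rowInsert v r)) A

appended : Word → Array → Word
appended r [] = []
appended r ((i , v) ∷ A) with rowInsert v r
... | (r′ , nothing) = i ∷ appended r′ A
... | (r′ , just y) = appended r′ A

bumped : Word → Array → Array
bumped r [] = []
bumped r ((i , v) ∷ A) with rowInsert v r
... | (r′ , nothing) = bumped r′ A
... | (r′ , just y) = (i , y) ∷ bumped r′ A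

rskFrom-topRow : ∀ r rs q qs A → rskFrom (r ∷ rs , q ∷ qs) A ≡
  Prod.map (insertAll r A ∷_) ((q ++ appended r A) ∷_) (rskFrom (rs , qs) (bumped r A))
rskFrom-topRow r rs q qs [] = cong (λ q′ → (r ∷ rs , q′ ∷ qs)) (sym (++-identityʳ q))
rskFrom-topRow r rs q qs ((i , v) ∷ A) with rowInsert v r
... | (r′ , nothing) = trans (rskFrom-topRow r′ rs (q ++ [ i ]) qs A)
  (cong (λ q′ → Prod.map (insertAll r′ A ∷_) (q′ ∷_) (rskFrom (rs , qs) (bumped r′ A)))
    (++-assoc q [ i ] (appended r′ A)))
... | (r′ , just y) with insertT y rs
...   | (rs′ , k) = rskFrom-topRow r′ rs′ q (addAt k i qs) A

RSK-∷ : ∀ c A → RSK (c ∷ A) ≡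
  Prod.map (insertAll [] (c ∷ A) ∷_) (appended [] (c ∷ A) ∷_) (RSK (bumped [] (c ∷ A)))
RSK-∷ (i , v) A = rskFrom-topRow (v ∷ []) [] (i ∷ []) [] A

RSK-bumped : ∀ A → RSK (bumped [] A) ≡ (hat (P A) , hat (Q A))
RSK-bumped [] = refl
RSK-bumped (c ∷ A) = cong (Prod.map hat hat) (sym (RSK-∷ c A))

bumped-length : ∀ r A → length (bumped r A) ≤ length A
bumped-length r [] = z≤n
bumped-length r ((i , v) ∷ A) with rowInsert v r
... | (r′ , nothing) = m≤n⇒m≤1+n (bumped-length r′ A)
... | (r′ , just y) = s≤s (bumped-length r′ A)

bumped-positive : ∀ r A → All (1 ≤_) r → All Positive A → All Positive (bumped r A)
bumped-positive r [] _ _ = []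
bumped-positive r ((i , v) ∷ A) pr ((1≤i , 1≤v) ∷ pA) with rowInsert v r | rowInsert-view v r
... | (r′ , nothing) | p = bumped-positive r′ A (RowInsert-All pr 1≤v p) pA
... | (r′ , just y) | p =
  (1≤i , All.lookup pr (proj₁ (RowInsert-just p))) ∷ bumped-positive r′ A (RowInsert-All pr 1≤v p) pA

Linked-fromMaybe-++ : ∀ {R : Column → Column → Set} {c x xs} → MaybeAll.All (λ c₀ → R c₀ x) c →
  Linked R (x ∷ xs) → Linked R (fromMaybe c ++ x ∷ xs)
Linked-fromMaybe-++ nothing l = l
Linked-fromMaybe-++ (just Rc₀x) l = Rc₀x ∷ l

-- While running columns through the top row r, (i₀ , v₀) is the last
-- column processed and c the last bumped column produced so far.
data BumpInvariant (r : Word) (i₀ v₀ : ℕ) : Maybe Column → Set where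
  afterAppend : ∀ {c} → All (_≤ v₀) r → MaybeAll.All (λ c₀ → proj₁ c₀ ≤ i₀) c → BumpInvariant r i₀ v₀ c
  afterBump   : ∀ {y₀} → (∀ {x} → x ∈ r → v₀ < x → y₀ ≤ x) → BumpInvariant r i₀ v₀ (just (i₀ , y₀))

BumpInvariant-index : ∀ {r i₀ v₀ c} → BumpInvariant r i₀ v₀ c → MaybeAll.All (λ c₀ → proj₁ c₀ ≤ i₀) c
BumpInvariant-index (afterAppend _ c≤i₀) = c≤i₀
BumpInvariant-index (afterBump _) = just ≤-refl

bump-≥lex-previous : ∀ {r i₀ v₀ c i v y} → BumpInvariant r i₀ v₀ c → (i₀ , v₀) ≤lex (i , v) →
  y ∈ r → v < y → MaybeAll.All (_≤lex (i , y)) c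
bump-≥lex-previous (afterAppend _ ic≤i₀) (inj₁ i₀<i) _ _ =
  MaybeAll.map (λ ic≤i₀ → inj₁ (≤-<-trans ic≤i₀ i₀<i)) ic≤i₀
bump-≥lex-previous (afterAppend r≤v₀ _) (inj₂ (refl , v₀≤v)) y∈r v<y =
  ⊥-elim (<⇒≱ v<y (≤-trans (All.lookup r≤v₀ y∈r) v₀≤v))
bump-≥lex-previous (afterBump _) (inj₁ i₀<i) _ _ = just (inj₁ i₀<i)
bump-≥lex-previous (afterBump y₀≤) (inj₂ (refl , v₀≤v)) y∈r v<y =
  just (inj₂ (refl , y₀≤ y∈r (≤-<-trans v₀≤v v<y)))

bumped-linked : ∀ r A {i₀ v₀ c} → Sorted r → BumpInvariant r i₀ v₀ c →
  Linked _≤lex_ ((i₀ , v₀) ∷ A) → Linked _≤lex_ (fromMaybe c ++ bumped r A)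
bumped-linked r [] {c = nothing} _ _ _ = []
bumped-linked r [] {c = just _} _ _ _ = [-]
bumped-linked r ((i , v) ∷ A) {c = c} sr inv (le ∷ l) with rowInsert v r | rowInsert-view v r
... | (r′ , nothing) | p =
  bumped-linked r′ A (RowInsert-sorted sr p) (afterAppend (RowInsert-append-≤ p) c≤i) l
  where
  c≤i = MaybeAll.map (λ ic≤i₀ → ≤-trans ic≤i₀ (≤lex⇒≤ le)) (BumpInvariant-index inv)
... | (r′ , just y) | p =
  Linked-fromMaybe-++ (bump-≥lex-previous inv le y∈r v<y)
    (bumped-linked r′ A (RowInsert-sorted sr p) (afterBump (RowInsert-bumped-≤ sr p)) l)
  where
  y∈r = proj₁ (RowInsert-just p)
  v<y = proj₂ (RowInsert-just p)

bumped-sorted : ∀ A → Linked _≤lex_ A → Linked _≤lex_ (bumped [] A)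
bumped-sorted [] _ = []
bumped-sorted (c ∷ A) l = bumped-linked [] (c ∷ A) [] (afterAppend [] nothing) (zero-≤lex c ∷ l)

bumped-sortedArray : ∀ A → SortedArray A → SortedArray (bumped [] A)
bumped-sortedArray A = Linked⇒AllPairs ≤lex-trans ∘ bumped-sorted A ∘ AllPairs⇒Linked

bumped-isTwoLineArray : ∀ {A} → IsTwoLineArray A → IsTwoLineArray (bumped [] A)
bumped-isTwoLineArray {A} (positive , sorted) = bumped-positive [] A [] positive , bumped-sorted A sorted

-- Records

<ᵇ-true : ∀ {m n} → m < n → (m <ᵇ n) ≡ true
<ᵇ-true {m} {n} m<n with m <ᵇ n | <ᵇ-reflects-< m n
... | true  | _ = refl
... | false | ofⁿ m≮n = ⊥-elim (m≮n m<n)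

<ᵇ-false : ∀ {m n} → ¬ m < n → (m <ᵇ n) ≡ false
<ᵇ-false {m} {n} m≮n with m <ᵇ n | <ᵇ-reflects-< m n
... | true  | ofʸ m<n = ⊥-elim (m≮n m<n)
... | false | _ = refl

-- Scanning the values of A from x on, a "record" is a value strictly below
-- all earlier ones.  When A is inserted into a row with first entry x, the
-- records are exactly the values that bump the first entry of the row.
runningMin : ℕ → Array → ℕ
runningMin x [] = x
runningMin x ((j , w) ∷ A) with w <ᵇ x
... | true  = runningMin w A
... | false = runningMin x A

nonRecords : ℕ → Array → Array
nonRecords x [] = []
nonRecords x ((j , w) ∷ A) with w <ᵇ x
... | true  = nonRecords w A
... | false = (j , w) ∷ nonRecords x A

-- A record (j , w) bumps the previous record out of the row.
recordBumps : ℕ → Array → Array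
recordBumps x [] = []
recordBumps x ((j , w) ∷ A) with w <ᵇ x
... | true  = (j , x) ∷ recordBumps w A
... | false = recordBumps x A

runningMin-≤ : ∀ x A → runningMin x A ≤ x
runningMin-≤ x [] = ≤-refl
runningMin-≤ x ((j , w) ∷ A) with w <ᵇ x | <ᵇ-reflects-< w x
... | true  | ofʸ w<x = ≤-trans (runningMin-≤ w A) (<⇒≤ w<x)
... | false | _ = runningMin-≤ x A

nonRecords-All : ∀ {P : Column → Set} x A → All P A → All P (nonRecords x A)
nonRecords-All x [] _ = []
nonRecords-All x ((j , w) ∷ A) (p ∷ ps) with w <ᵇ x
... | true  = nonRecords-All w A ps
... | false = p ∷ nonRecords-All x A ps

nonRecords-sorted : ∀ x A → SortedArray A → SortedArray (nonRecords x A)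
nonRecords-sorted x [] _ = []
nonRecords-sorted x ((j , w) ∷ A) (p ∷ ps) with w <ᵇ x
... | true  = nonRecords-sorted w A ps
... | false = nonRecords-All x A p ∷ nonRecords-sorted x A ps

nonRecords-length : ∀ x A → length (nonRecords x A) ≤ length A
nonRecords-length x [] = z≤n
nonRecords-length x ((j , w) ∷ A) with w <ᵇ x
... | true  = m≤n⇒m≤1+n (nonRecords-length w A)
... | false = s≤s (nonRecords-length x A)

runningMin-nonRecord : ∀ x L M {j w} → ¬ w < runningMin x L →
  runningMin x (L ++ (j , w) ∷ M) ≡ runningMin x (L ++ M)
runningMin-nonRecord x [] M w≮x rewrite <ᵇ-false w≮x = refl
runningMin-nonRecord x ((j′ , w′) ∷ L) M w≮ with w′ <ᵇ x
... | true  = runningMin-nonRecord w′ L M w≮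
... | false = runningMin-nonRecord x L M w≮

nonRecords-nonRecord : ∀ x L M {j w} → ¬ w < runningMin x L →
  nonRecords x (L ++ (j , w) ∷ M) ↭ (j , w) ∷ nonRecords x (L ++ M)
nonRecords-nonRecord x [] M w≮x rewrite <ᵇ-false w≮x = ↭-refl
nonRecords-nonRecord x ((j′ , w′) ∷ L) M w≮ with w′ <ᵇ x
... | true  = nonRecords-nonRecord w′ L M w≮
... | false = ↭-trans (↭-prep _ (nonRecords-nonRecord x L M w≮)) (↭-swap _ _ ↭-refl)

recordBumps-nonRecord : ∀ x L M {j w} → ¬ w < runningMin x L →
  recordBumps x (L ++ (j , w) ∷ M) ≡ recordBumps x (L ++ M)
recordBumps-nonRecord x [] M w≮x rewrite <ᵇ-false w≮x = refl
recordBumps-nonRecord x ((j′ , w′) ∷ L) M w≮ with w′ <ᵇ x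
... | true  = cong (_ ∷_) (recordBumps-nonRecord w′ L M w≮)
... | false = recordBumps-nonRecord x L M w≮

runningMin-record : ∀ x L M {j w} → w < runningMin x L →
  runningMin x (L ++ (j , w) ∷ M) ≡ runningMin w M
runningMin-record x [] M w<x rewrite <ᵇ-true w<x = refl
runningMin-record x ((j′ , w′) ∷ L) M w< with w′ <ᵇ x
... | true  = runningMin-record w′ L M w<
... | false = runningMin-record x L M w<

nonRecords-record : ∀ x L M {j w} → w < runningMin x L →
  nonRecords x (L ++ (j , w) ∷ M) ≡ nonRecords x L ++ nonRecords w M
nonRecords-record x [] M w<x rewrite <ᵇ-true w<x = refl
nonRecords-record x ((j′ , w′) ∷ L) M w< with w′ <ᵇ x
... | true  = nonRecords-record w′ L M w<
... | false = cong (_ ∷_) (nonRecords-record x L M w<)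

recordBumps-record : ∀ x L M {j w} → w < runningMin x L →
  recordBumps x (L ++ (j , w) ∷ M) ≡ recordBumps x L ++ (j , runningMin x L) ∷ recordBumps w M
recordBumps-record x [] M w<x rewrite <ᵇ-true w<x = refl
recordBumps-record x ((j′ , w′) ∷ L) M w< with w′ <ᵇ x
... | true  = cong (_ ∷_) (recordBumps-record w′ L M w<)
... | false = recordBumps-record x L M w<

insertAll-∷ : ∀ x t A → insertAll (x ∷ t) A ≡ runningMin x A ∷ insertAll t (nonRecords x A)
insertAll-∷ x t [] = refl
insertAll-∷ x t ((j , w) ∷ A) with w <ᵇ x
... | true  = insertAll-∷ w t A
... | false = insertAll-∷ x (proj₁ (rowInsert w t)) A

appended-∷ : ∀ x t A → appended (x ∷ t) A ≡ appended t (nonRecords x A)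
appended-∷ x t [] = refl
appended-∷ x t ((j , w) ∷ A) with w <ᵇ x
... | true  = appended-∷ w t A
... | false with rowInsert w t
...   | (t′ , nothing) = cong (j ∷_) (appended-∷ x t′ A)
...   | (t′ , just y) = appended-∷ x t′ A

bumped-∷ : ∀ x t A → bumped (x ∷ t) A ↭ recordBumps x A ++ bumped t (nonRecords x A)
bumped-∷ x t [] = ↭-refl
bumped-∷ x t ((j , w) ∷ A) with w <ᵇ x
... | true  = ↭-prep _ (bumped-∷ w t A)
... | false with rowInsert w t
...   | (t′ , nothing) = bumped-∷ x t′ A
...   | (t′ , just y) = ↭-trans (↭-prep _ (bumped-∷ x t′ A)) (↭-sym (shift _ (recordBumps x A) _))

-- Symmetry of RSK

AllPairs-remove : ∀ {R : Column → Column → Set} X {e Y} → AllPairs R (X ++ e ∷ Y) →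
  All (λ x → R x e) X × AllPairs R (X ++ Y)
AllPairs-remove [] (_ ∷ p) = [] , p
AllPairs-remove (x ∷ X) (x≤ ∷ p) with AllPairs-remove X p | All-++⁻ X x≤
... | X≤e , pXY | x≤X , x≤e ∷ x≤Y = x≤e ∷ X≤e , All-++⁺ x≤X x≤Y ∷ pXY

-- (i , v) ∷ A and (v′ , i′) ∷ S hold the same columns (S with rows
-- swapped), sorted by index and by value respectively: then the record
-- scans of the values of A and of the indices of S match up.
record RunningMinDuality (i v : ℕ) (A : Array) (v′ i′ : ℕ) (S : Array) : Set where
  field
    runningMin-indices : runningMin i′ S ≡ i
    runningMin-values  : v′ ≡ runningMin v A
    nonRecords-↭       : nonRecords i′ S ↭ map swap (nonRecords v A)
    recordBumps-↭      : recordBumps i′ S ↭ map swap (recordBumps v A)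

duality-nonRecord : ∀ {i v B I V v′ i′} X Y → runningMin v B ≤ V → i′ ≤ I →
  RunningMinDuality i v B v′ i′ (X ++ Y) →
  RunningMinDuality i v (B ∷ʳ (I , V)) v′ i′ (X ++ (V , I) ∷ Y)
duality-nonRecord {v = v} {B} {I} {V} {i′ = i′} X Y m≤V i′≤I D = record
  { runningMin-indices = trans (runningMin-nonRecord i′ X Y I≮) runningMin-indices
  ; runningMin-values  = trans runningMin-values (sym (trans
      (runningMin-nonRecord v B [] V≮) (cong (runningMin v) (++-identityʳ B))))
  ; nonRecords-↭ = begin
      nonRecords i′ (X ++ (V , I) ∷ Y)        ↭⟨ nonRecords-nonRecord i′ X Y I≮ ⟩
      (V , I) ∷ nonRecords i′ (X ++ Y)        ↭⟨ ↭-prep _ nonRecords-↭ ⟩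
      map swap ((I , V) ∷ nonRecords v B)     ≡⟨ cong (λ B′ → map swap ((I , V) ∷ nonRecords v B′)) (++-identityʳ B) ⟨
      map swap ((I , V) ∷ nonRecords v (B ++ [])) ↭⟨ ↭-map⁺ swap (nonRecords-nonRecord v B [] V≮) ⟨
      map swap (nonRecords v (B ∷ʳ (I , V)))  ∎
  ; recordBumps-↭ = begin
      recordBumps i′ (X ++ (V , I) ∷ Y)       ≡⟨ recordBumps-nonRecord i′ X Y I≮ ⟩
      recordBumps i′ (X ++ Y)                 ↭⟨ recordBumps-↭ ⟩
      map swap (recordBumps v B)              ≡⟨ cong (map swap ∘ recordBumps v) (++-identityʳ B) ⟨
      map swap (recordBumps v (B ++ []))      ≡⟨ cong (map swap) (recordBumps-nonRecord v B [] V≮) ⟨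
      map swap (recordBumps v (B ∷ʳ (I , V))) ∎
  }
  where
  open RunningMinDuality D
  open PermutationReasoning
  I≮ : ¬ I < runningMin i′ X
  I≮ I< = <⇒≱ I< (≤-trans (runningMin-≤ i′ X) i′≤I)
  V≮ : ¬ V < runningMin v B
  V≮ = ≤⇒≯ m≤V

duality-record : ∀ {i v B I V v₁ i₁ Y} → V < runningMin v B → i₁ < I →
  RunningMinDuality i v B v₁ i₁ Y →
  RunningMinDuality i v (B ∷ʳ (I , V)) V I ((v₁ , i₁) ∷ Y)
duality-record {v = v} {B} {I} {V} {v₁} {i₁} {Y} V<m i₁<I D = record
  { runningMin-indices = trans (runningMin-record I [] Y {v₁} i₁<I) runningMin-indices
  ; runningMin-values  = sym (runningMin-record v B [] V<m)
  ; nonRecords-↭ = begin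
      nonRecords I ((v₁ , i₁) ∷ Y)            ≡⟨ nonRecords-record I [] Y i₁<I ⟩
      nonRecords i₁ Y                         ↭⟨ nonRecords-↭ ⟩
      map swap (nonRecords v B)               ≡⟨ cong (map swap) (++-identityʳ (nonRecords v B)) ⟨
      map swap (nonRecords v B ++ [])         ≡⟨ cong (map swap) (nonRecords-record v B [] V<m) ⟨
      map swap (nonRecords v (B ∷ʳ (I , V)))  ∎
  ; recordBumps-↭ = begin
      recordBumps I ((v₁ , i₁) ∷ Y)           ≡⟨ recordBumps-record I [] Y i₁<I ⟩
      (v₁ , I) ∷ recordBumps i₁ Y             ↭⟨ ↭-prep _ recordBumps-↭ ⟩
      (v₁ , I) ∷ map swap (recordBumps v B)   ≡⟨ cong (λ m → (m , I) ∷ map swap (recordBumps v B)) runningMin-values ⟩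
      map swap ((I , runningMin v B) ∷ recordBumps v B) ↭⟨ ∷↭∷ʳ _ _ ⟩
      map swap (recordBumps v B) ∷ʳ (runningMin v B , I) ≡⟨ map-++ swap (recordBumps v B) _ ⟨
      map swap (recordBumps v B ∷ʳ (I , runningMin v B)) ≡⟨ cong (map swap) (recordBumps-record v B [] V<m) ⟨
      map swap (recordBumps v (B ∷ʳ (I , V))) ∎
  }
  where
  open RunningMinDuality D
  open PermutationReasoning

-- The column (I , V) heads S: it is either a new record or a repeat of
-- the column that follows it.
duality-head : ∀ {i v B I V v₁ i₁ Y} → (V , I) ≤lex (v₁ , i₁) → (i₁ , v₁) ≤lex (I , V) →
  RunningMinDuality i v B v₁ i₁ Y → RunningMinDuality i v (B ∷ʳ (I , V)) V I ((v₁ , i₁) ∷ Y)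
duality-head {v = v} {B} {I} {V} IV≤ ≤IV D with V <? runningMin v B
... | yes V<m = duality-record V<m (≤lex-index-< ≤IV (subst (V <_) (sym runningMin-values) V<m)) D
  where open RunningMinDuality D
... | no V≮m with refl ← ≤lex-swap-antisym IV≤ ≤IV
  (subst (_≤ V) (sym (RunningMinDuality.runningMin-values D)) (≮⇒≥ V≮m)) =
  duality-nonRecord [] _ (≮⇒≥ V≮m) ≤-refl D

runningMin-duality : ∀ {i v A} → Reverse A → ∀ {v′ i′} S →
  SortedArray ((i , v) ∷ A) → SortedArray ((v′ , i′) ∷ S) →
  (v′ , i′) ∷ S ↭ map swap ((i , v) ∷ A) → RunningMinDuality i v A v′ i′ S
runningMin-duality [] S _ _ p with refl ← ↭-singleton-inv p = record
  { runningMin-indices = refl ; runningMin-values = refl ; nonRecords-↭ = ↭-refl ; recordBumps-↭ = ↭-refl }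
-- Remove the last column (I , V) of A and its copy (V , I) from S.
runningMin-duality {i} {v} (B ∶ rB ∶ʳ (I , V)) S sA sS p
  with X , Y , eq ← ∈-∃++ (∈-resp-↭ (↭-sym p) (∈-map⁺ swap (∈-++⁺ʳ ((i , v) ∷ B) (here refl)))) =
  snoc X Y eq (subst SortedArray eq sS) (withoutLast X Y (subst (_↭ _) eq p))
  where
  sB,belowIV = AllPairs-remove ((i , v) ∷ B) {Y = []} sA
  sB : SortedArray ((i , v) ∷ B)
  sB = subst SortedArray (++-identityʳ _) (proj₂ sB,belowIV)

  withoutLast : ∀ X Y → X ++ (V , I) ∷ Y ↭ map swap ((i , v) ∷ B ∷ʳ (I , V)) → X ++ Y ↭ map swap ((i , v) ∷ B)
  withoutLast X Y q = ↭-trans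
    (drop-mid X (map swap ((i , v) ∷ B)) (↭-trans q (↭-reflexive (map-++ swap ((i , v) ∷ B) _))))
    (↭-reflexive (++-identityʳ _))

  swapped-belowIV : ∀ {Z} → Z ↭ map swap ((i , v) ∷ B) → All (λ c → swap c ≤lex (I , V)) Z
  swapped-belowIV q = All-resp-↭ (↭-sym q) (All-map⁺ (proj₁ sB,belowIV))

  snoc : ∀ {v′ i′ S} X Y → (v′ , i′) ∷ S ≡ X ++ (V , I) ∷ Y → SortedArray (X ++ (V , I) ∷ Y) →
    X ++ Y ↭ map swap ((i , v) ∷ B) → RunningMinDuality i v (B ∷ʳ (I , V)) v′ i′ S
  snoc [] [] refl _ rest with () ← ↭-empty-inv (↭-sym rest)
  snoc [] ((v₁ , i₁) ∷ Y) refl (IV≤ ∷ sY) rest =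
    duality-head (All.head IV≤) (All.head (swapped-belowIV rest)) (runningMin-duality rB Y sB sY rest)
  snoc ((v′ , i′) ∷ X) Y refl sS rest = duality-nonRecord X Y m≤V i′≤I D
    where
    sS′ = AllPairs-remove ((v′ , i′) ∷ X) sS
    D = runningMin-duality rB (X ++ Y) sB (proj₂ sS′) rest
    m≤V = subst (_≤ V) (RunningMinDuality.runningMin-values D) (≤lex⇒≤ (All.head (proj₁ sS′)))
    i′≤I = ≤lex⇒≤ (All.head (swapped-belowIV rest))

-- n is fuel for the recursion on nonRecords.
topRow-duality : ∀ n A S → length A ≤ n → SortedArray A → SortedArray S → S ↭ map swap A →
  insertAll [] S ≡ appended [] A × appended [] S ≡ insertAll [] A × bumped [] S ↭ map swap (bumped [] A)
topRow-duality n [] S _ _ _ p with refl ← ↭-empty-inv p = refl , refl , ↭-refl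
topRow-duality n (_ ∷ _) [] _ _ _ p with () ← ↭-empty-inv (↭-sym p)
topRow-duality (suc n) ((i , v) ∷ A) ((v′ , i′) ∷ S) (s≤s |A|≤n) sA sS p =
  insertAll-S , appended-S , bumped-S
  where
  open RunningMinDuality (runningMin-duality (reverseView A) S sA sS p)
  ih = topRow-duality n (nonRecords v A) (nonRecords i′ S) (≤-trans (nonRecords-length v A) |A|≤n)
    (nonRecords-sorted v A (AllPairs.tail sA)) (nonRecords-sorted i′ S (AllPairs.tail sS)) nonRecords-↭
  insertAll-S : insertAll [ i′ ] S ≡ i ∷ appended [ v ] A
  insertAll-S = begin
    insertAll [ i′ ] S                                 ≡⟨ insertAll-∷ i′ [] S ⟩
    runningMin i′ S ∷ insertAll [] (nonRecords i′ S)   ≡⟨ cong₂ _∷_ runningMin-indices (proj₁ ih) ⟩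
    i ∷ appended [] (nonRecords v A)                   ≡⟨ cong (i ∷_) (appended-∷ v [] A) ⟨
    i ∷ appended [ v ] A                               ∎
    where open ≡-Reasoning
  appended-S : v′ ∷ appended [ i′ ] S ≡ insertAll [ v ] A
  appended-S = begin
    v′ ∷ appended [ i′ ] S                             ≡⟨ cong (v′ ∷_) (appended-∷ i′ [] S) ⟩
    v′ ∷ appended [] (nonRecords i′ S)                 ≡⟨ cong₂ _∷_ runningMin-values (proj₁ (proj₂ ih)) ⟩
    runningMin v A ∷ insertAll [] (nonRecords v A)     ≡⟨ insertAll-∷ v [] A ⟨
    insertAll [ v ] A                                  ∎
    where open ≡-Reasoning
  bumped-S : bumped [ i′ ] S ↭ map swap (bumped [ v ] A)
  bumped-S = begin
    bumped [ i′ ] S                                                        ↭⟨ bumped-∷ i′ [] S ⟩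
    recordBumps i′ S ++ bumped [] (nonRecords i′ S)                        ↭⟨ ↭-++⁺ recordBumps-↭ (proj₂ (proj₂ ih)) ⟩
    map swap (recordBumps v A) ++ map swap (bumped [] (nonRecords v A))    ≡⟨ map-++ swap (recordBumps v A) _ ⟨
    map swap (recordBumps v A ++ bumped [] (nonRecords v A))               ↭⟨ ↭-map⁺ swap (bumped-∷ v [] A) ⟨
    map swap (bumped [ v ] A)                                              ∎
    where open PermutationReasoning

RSK-swap : ∀ n A S → length A ≤ n → SortedArray A → SortedArray S → S ↭ map swap A →
  RSK S ≡ swap (RSK A)
RSK-swap n [] S _ _ _ p with refl ← ↭-empty-inv p = refl
RSK-swap n (_ ∷ _) [] _ _ _ p with () ← ↭-empty-inv (↭-sym p)
RSK-swap (suc n) (c@(_ , v) ∷ A) (d ∷ S) (s≤s |A|≤n) sA sS p = begin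
  RSK (d ∷ S)                                    ≡⟨ RSK-∷ d S ⟩
  Prod.map (insertAll [] (d ∷ S) ∷_) (appended [] (d ∷ S) ∷_) (RSK (bumped [] (d ∷ S)))
    ≡⟨ cong₂ (λ x y → Prod.map (x ∷_) (y ∷_) (RSK (bumped [] (d ∷ S)))) insertAll-S appended-S ⟩
  Prod.map (appended [] (c ∷ A) ∷_) (insertAll [] (c ∷ A) ∷_) (RSK (bumped [] (d ∷ S)))
    ≡⟨ cong (Prod.map (appended [] (c ∷ A) ∷_) (insertAll [] (c ∷ A) ∷_)) ih ⟩
  swap (Prod.map (insertAll [] (c ∷ A) ∷_) (appended [] (c ∷ A) ∷_) (RSK (bumped [] (c ∷ A))))
    ≡⟨ cong swap (RSK-∷ c A) ⟨
  swap (RSK (c ∷ A))                             ∎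
  where
  open ≡-Reasoning
  top = topRow-duality (suc n) (c ∷ A) (d ∷ S) (s≤s |A|≤n) sA sS p
  insertAll-S = proj₁ top
  appended-S = proj₁ (proj₂ top)
  ih = RSK-swap n (bumped [] (c ∷ A)) (bumped [] (d ∷ S)) (≤-trans (bumped-length [ v ] A) |A|≤n)
    (bumped-sortedArray (c ∷ A) sA) (bumped-sortedArray (d ∷ S) sS) (proj₂ (proj₂ top))

RSK-⋆ : ∀ {A} → IsTwoLineArray A → RSK (A ⋆) ≡ swap (RSK A)
RSK-⋆ {A} (_ , sorted) =
  RSK-swap (length A) A (A ⋆) ≤-refl (Linked⇒AllPairs ≤lex-trans sorted) (⋆-sorted A) (⋆-↭ A)

IsF-values : ∀ {A B p q} → IsF A B p q → values A ≡ᵢ (values B ++ p)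
IsF-values {A} {B} {p} (_ , RSK-B , p≡ , _) = begin
  values A                             ≈⟨ ≡ᵢ-reading-P A ⟩
  reading (P A)                        ≡⟨ reading-hat (P A) ⟩
  reading (hat (P A)) ++ topRow (P A)  ≡⟨ cong₂ _++_ (cong (reading ∘ proj₁) RSK-B) p≡ ⟨
  reading (P B) ++ p                   ≈⟨ ≡ᵢ-++ʳ p (≡ᵢ-reading-P B) ⟨
  values B ++ p                        ∎
  where open ≡ᵢ-Reasoning

IsF-⋆ : ∀ {A B p q} → IsTwoLineArray A → IsF A B p q → IsF (A ⋆) (B ⋆) q p
IsF-⋆ tA (tB , RSK-B , p≡ , q≡) =
  ⋆-isTwoLineArray tB ,
  trans (RSK-⋆ tB) (trans (cong swap RSK-B) (cong (Prod.map hat hat) (sym (RSK-⋆ tA)))) ,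
  trans q≡ (cong (topRow ∘ proj₁) (sym (RSK-⋆ tA))) ,
  trans p≡ (cong (topRow ∘ proj₂) (sym (RSK-⋆ tA)))

lemma4p23 : ∀ (A : Array) → IsTwoLineArray A →
    (Σ Array λ B → IsF A B (topRow (P A)) (topRow (Q A))) ×
    (∀ B p q → IsF A B p q →
      (values A ≡ᵢ (values B ++ p)) × IsF (A ⋆) (B ⋆) q p)
lemma4p23 A tA =
  (bumped [] A , bumped-isTwoLineArray tA , RSK-bumped A , refl , refl) ,
  λ B p q isF → IsF-values isF , IsF-⋆ tA isF
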